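{- Let $q>2$ with $q\neq 6$, and let $w\in\mathbb{Z}_q$ be a non-unit, i.e.\ $\gcd(w,q)\neq 1$. Then there exists $d\in\{1,2,\ldots,\lfloor (q-1)/2\rfloor\}$ such that $w-d$ is a unit in $\mathbb{Z}_q$. -}

module Defs where

open import Data.Nat using (ℕ; _+_; _∸_; _%_; NonZero)
open import Data.Nat.GCD using (gcd)
open import Relation.Binary.PropositionalEquality using (_≡_)

-- Elements of ℤ_q are represented by their canonical residues in {0,…,q-1}.
-- A residue a is a unit of ℤ_q iff gcd(a, q) = 1.
IsUnitMod : ℕ → ℕ → Set
IsUnitMod q a = gcd a q ≡ 1

-- Subtraction in ℤ_q on residues: (w - d) mod q, computed as (w + (q - d)) mod q
-- (valid for d ≤ q, which is the case used here).
subMod : (q : ℕ) .{{_ : NonZero q}} → ℕ → ℕ → ℕ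
subMod q w d = (w + (q ∸ d)) % q

{-# OPTIONS --safe #-}
module Submission where

-- Let h = ⌊(q − 1)/2⌋. For w = 0 take d = 1, as q − 1 is a unit; for 2 ≤ w ≤ h + 1 take
-- d = w − 1, as 1 is a unit. For larger w it suffices to find a unit u with u < w ≤ u + h
-- and take d = w − u. Since w is not a unit, any unit u with h < u ≤ w does: u = h + 1 if q
-- is odd, u = q/2 + 1 if 4 ∣ q, and u = q/2 + 2 if q ≡ 2 (mod 4). In the last case the
-- remaining w = q/2 + 1 is served by the unit q/2 − 2, whose window reaches w once q ≥ 10.

open import Defs
open import Data.Nat using (ℕ; _<_; _≤_; _∸_; _/_; NonZero)
open import Data.Product using (∃-syntax; _×_)
open import Relation.Binary.PropositionalEquality using (_≢_)
open import Relation.Nullary using (¬_)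

open import Data.Nat using (zero; suc; _+_; _*_; _%_; _≤?_; z≤n; s≤s; s≤s⁻¹; z<s)
open import Data.Nat.Properties
open import Data.Nat.DivMod using (m<n⇒m%n≡m; [m+n]%n≡m%n; m*n/n≡m; +-distrib-/-∣ʳ; m≥n⇒m/n>0)
open import Data.Nat.Divisibility using (_∣_; divides-refl; ∣-trans; ∣1⇒≡1; ∣m+n∣m⇒∣n; ∣m⇒∣m*n)
open import Data.Nat.Coprimality using (Coprime; coprime⇒gcd≡1; 1-coprimeTo; coprime-divisor)
import Data.Nat.Coprimality as Coprimality
open import Data.Nat.Tactic.RingSolver using (solve-∀)
open import Data.Product using (_,_)
open import Data.Sum using (inj₁; inj₂)
open import Data.Empty using (⊥-elim)
open import Relation.Nullary using (yes; no)
open import Relation.Binary.PropositionalEquality using (_≡_; refl; sym; cong; subst; module ≡-Reasoning)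

a*x≡b*y+1⇒coprime : ∀ {a b} x y → a * x ≡ b * y + 1 → Coprime a b
a*x≡b*y+1⇒coprime x y eq {i} (i∣a , i∣b) =
  ∣1⇒≡1 (∣m+n∣m⇒∣n (subst (i ∣_) eq (∣m⇒∣m*n x i∣a)) (∣m⇒∣m*n y i∣b))

coprime-* : ∀ {a b c} → Coprime a b → Coprime a c → Coprime a (b * c)
coprime-* a⊥b a⊥c (i∣a , i∣bc) =
  a⊥c (i∣a , coprime-divisor (λ (j∣i , j∣b) → a⊥b (∣-trans j∣i i∣a , j∣b)) i∣bc)

1+n-coprime-n : ∀ n → Coprime (suc n) n
1+n-coprime-n n = a*x≡b*y+1⇒coprime 1 1 (+-comm 1 (n * 1))

odd-coprime-2 : ∀ k → Coprime (suc (k * 2)) 2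
odd-coprime-2 k = a*x≡b*y+1⇒coprime 1 k (identity k)
  where
  identity : ∀ k → suc (k * 2) * 1 ≡ 2 * k + 1
  identity = solve-∀

odd+2-coprime-odd : ∀ k → Coprime (suc (suc (suc (k * 2)))) (suc (k * 2))
odd+2-coprime-odd k = a*x≡b*y+1⇒coprime (suc k) (suc (suc k)) (identity k)
  where
  identity : ∀ k → suc (suc (suc (k * 2))) * suc k ≡ suc (k * 2) * suc (suc k) + 1
  identity = solve-∀

odd-coprime-double : ∀ k {m} → Coprime (suc (k * 2)) m → Coprime (suc (k * 2)) (m * 2)
odd-coprime-double k u⊥m = coprime-* u⊥m (odd-coprime-2 k)

1+h-coprime-1+2h : ∀ h → Coprime (suc h) (suc (h * 2))
1+h-coprime-1+2h h = a*x≡b*y+1⇒coprime 2 1 (identity h)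
  where
  identity : ∀ h → suc h * 2 ≡ suc (h * 2) * 1 + 1
  identity = solve-∀

data EvenOrOdd : ℕ → Set where
  even : ∀ k → EvenOrOdd (k * 2)
  odd  : ∀ k → EvenOrOdd (suc (k * 2))

evenOrOdd : ∀ n → EvenOrOdd n
evenOrOdd zero = even 0
evenOrOdd (suc n) with evenOrOdd n
... | even k = odd k
... | odd k  = even (suc k)

data Halving : ℕ → ℕ → Set where
  2h+1 : ∀ h → Halving (suc (h * 2)) h
  2h+2 : ∀ h → Halving (suc h * 2) h

[1+h*2]/2≡h : ∀ h → suc (h * 2) / 2 ≡ h
[1+h*2]/2≡h h = begin
  (1 + h * 2) / 2   ≡⟨ +-distrib-/-∣ʳ 1 {d = 2} (divides-refl h) ⟩
  1 / 2 + h * 2 / 2 ≡⟨ m*n/n≡m h 2 ⟩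
  h                 ∎
  where open ≡-Reasoning

halving : ∀ n → Halving (suc n) (n / 2)
halving n with evenOrOdd n
... | even h = subst (Halving _) (sym (m*n/n≡m h 2)) (2h+1 h)
... | odd h  = subst (Halving _) (sym ([1+h*2]/2≡h h)) (2h+2 h)

h*2≡h+h : ∀ h → h * 2 ≡ h + h
h*2≡h+h = solve-∀

<-halving⇒≤1+h+h : ∀ {q h w} → Halving q h → w < q → w ≤ suc h + h
<-halving⇒≤1+h+h (2h+1 h) (s≤s w≤2h)   = m≤n⇒m≤1+n (≤-trans w≤2h (≤-reflexive (h*2≡h+h h)))
<-halving⇒≤1+h+h (2h+2 h) (s≤s w≤1+2h) = ≤-trans w≤1+2h (s≤s (≤-reflexive (h*2≡h+h h)))

subMod-∸ : ∀ {q u w} .{{_ : NonZero q}} → u ≤ w → w < q → subMod q w (w ∸ u) ≡ u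
subMod-∸ {q} {u} {w} u≤w w<q = begin
  (w + (q ∸ d)) % q     ≡⟨ cong (λ x → (x + (q ∸ d)) % q) (m+[n∸m]≡n u≤w) ⟨
  (u + d + (q ∸ d)) % q ≡⟨ cong (_% q) (+-assoc u d (q ∸ d)) ⟩
  (u + (d + (q ∸ d))) % q ≡⟨ cong (λ x → (u + x) % q) (m+[n∸m]≡n d≤q) ⟩
  (u + q) % q           ≡⟨ [m+n]%n≡m%n u q ⟩
  u % q                 ≡⟨ m<n⇒m%n≡m (≤-<-trans u≤w w<q) ⟩
  u                     ∎
  where
  open ≡-Reasoning
  d = w ∸ u
  d≤q : d ≤ q
  d≤q = ≤-trans (m∸n≤m w u) (<⇒≤ w<q)

UnitBelow : (q h w : ℕ) → Set
UnitBelow q h w = ∃[ u ] (IsUnitMod q u × u < w × w ≤ u + h)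

unitBelow⇒unitShift : ∀ {q h w} .{{_ : NonZero q}} → w < q → UnitBelow q h w →
                      ∃[ d ] (1 ≤ d × d ≤ h × IsUnitMod q (subMod q w d))
unitBelow⇒unitShift {q} {w = w} w<q (u , u-unit , u<w , w≤u+h) =
  w ∸ u , m<n⇒0<n∸m u<w , m≤n+o⇒m∸n≤o w u w≤u+h ,
  subst (IsUnitMod q) (sym (subMod-∸ (<⇒≤ u<w) w<q)) u-unit

unitBelow-high : ∀ {q h u w} → Halving q h → IsUnitMod q u → h < u → u ≤ w → w < q →
                 ¬ IsUnitMod q w → UnitBelow q h w
unitBelow-high {h = h} {u} q/2 u-unit h<u u≤w w<q w-nonunit with m≤n⇒m<n∨m≡n u≤w
... | inj₁ u<w = u , u-unit , u<w , ≤-trans (<-halving⇒≤1+h+h q/2 w<q) (+-monoˡ-≤ h h<u)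
... | inj₂ refl = ⊥-elim (w-nonunit u-unit)

unitBelow-large : ∀ {q h w} → Halving q h → 2 < q → q ≢ 6 →
                  suc h < w → w < q → ¬ IsUnitMod q w → UnitBelow q h w
unitBelow-large (2h+1 h) _ _ h+1<w w<q w-nonunit =
  unitBelow-high (2h+1 h) (coprime⇒gcd≡1 (1+h-coprime-1+2h h)) ≤-refl (<⇒≤ h+1<w) w<q w-nonunit
unitBelow-large (2h+2 h) 2<q q≢6 h+1<w w<q w-nonunit with evenOrOdd h
... | odd i =
  unitBelow-high (2h+2 h) (coprime⇒gcd≡1 (odd-coprime-double (suc i) (1+n-coprime-n (suc h))))
                 (m<n⇒m<1+n (n<1+n h)) h+1<w w<q w-nonunit
... | even 0 = ⊥-elim (<-irrefl refl 2<q)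
... | even 1 = ⊥-elim (q≢6 refl)
... | even (suc (suc i)) with m≤n⇒m<n∨m≡n h+1<w
...   | inj₁ h+2<w =
  unitBelow-high (2h+2 h)
                 (coprime⇒gcd≡1 (odd-coprime-double (suc (suc (suc i))) (odd+2-coprime-odd (suc (suc i)))))
                 (m<n⇒m<1+n (m<n⇒m<1+n (n<1+n h))) h+2<w w<q w-nonunit
...   | inj₂ refl =
  u , coprime⇒gcd≡1 (odd-coprime-double (suc i) (Coprimality.sym (odd+2-coprime-odd (suc i)))) ,
  m<n+m u {3} z<s , subst (_≤ u + h) (+-comm u 3) (+-monoʳ-≤ u 3≤h)
  where
  u = suc (suc i * 2)
  3≤h : 3 ≤ h
  3≤h = s≤s (s≤s (s≤s z≤n))

lemma11 : (q : ℕ) .{{_ : NonZero q}} → 2 < q → q ≢ 6 →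
    (w : ℕ) → w < q → ¬ IsUnitMod q w →
    ∃[ d ] (1 ≤ d × d ≤ (q ∸ 1) / 2 × IsUnitMod q (subMod q w d))
lemma11 q@(suc n) 2<q _ zero _ _ =
  1 , ≤-refl , m≥n⇒m/n>0 (s≤s⁻¹ 2<q) ,
  subst (IsUnitMod q) (sym (m<n⇒m%n≡m (n<1+n n))) (coprime⇒gcd≡1 (Coprimality.sym (1+n-coprime-n n)))
lemma11 q _ _ 1 _ 1-nonunit = ⊥-elim (1-nonunit (coprime⇒gcd≡1 (1-coprimeTo q)))
lemma11 q@(suc n) 2<q q≢6 w@(suc (suc _)) w<q w-nonunit = unitBelow⇒unitShift w<q unitBelow
  where
  unitBelow : UnitBelow q (n / 2) w
  unitBelow with w ≤? suc (n / 2)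
  ... | yes w≤1+h = 1 , coprime⇒gcd≡1 (1-coprimeTo q) , s≤s (s≤s z≤n) , w≤1+h
  ... | no w≰1+h  = unitBelow-large (halving n) 2<q q≢6 (≰⇒> w≰1+h) w<q w-nonunit
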